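{- Let $r\geqslant 3$, $t\geqslant 1$, $k$, $n$ be positive integers, and let $\mathcal{F}\subseteq\binom{[n]}{k}$ be an $r$-wise $t$-intersecting family with $\tau_t(\mathcal{F})=s$. Then $\mathcal{F}$ is $\left[(r-2)(s-t)+t\right]$-intersecting, i.e. $|F\cap F'|\geqslant (r-2)(s-t)+t$ for all $F,F'\in\mathcal{F}$.
   Context: $\binom{[n]}{k}$ is the family of $k$-subsets of $[n]=\{1,\dots,n\}$. A family is $\ell$-intersecting if any two of its members share at least $\ell$ elements, and $r$-wise $t$-intersecting if any $r$ of its members (not necessarily distinct) share at least $t$ elements. A set $T\subseteq[n]$ is a $t$-cover of $\mathcal{F}$ if $|T\cap F|\geqslant t$ for all $F\in\mathcal{F}$; the $t$-covering number $\tau_t(\mathcal{F})$ is the minimum size of a $t$-cover of $\mathcal{F}$. -}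

module Defs where

open import Data.Nat using (ℕ; _≤_)
open import Data.Fin using (Fin)
open import Data.Fin.Subset using (Subset; _∩_; ⋂; ∣_∣)
open import Data.List using (tabulate)
open import Relation.Unary using (Pred; _∈_)
open import Level using (0ℓ)
open import Data.Product using (Σ; _×_)
open import Relation.Binary.PropositionalEquality using (_≡_)

Family : ℕ → Set₁
Family n = Pred (Subset n) 0ℓ

IsUniform : ∀ {n} → ℕ → Family n → Set
IsUniform k 𝓕 = ∀ A → A ∈ 𝓕 → ∣ A ∣ ≡ k

IsIntersecting : ∀ {n} → ℕ → Family n → Set
IsIntersecting ℓ 𝓕 = ∀ A B → A ∈ 𝓕 → B ∈ 𝓕 → ℓ ≤ ∣ A ∩ B ∣

-- r-wise t-intersecting: any r members (not necessarily distinct) share ≥ t elements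
IsRWiseIntersecting : ∀ {n} → ℕ → ℕ → Family n → Set
IsRWiseIntersecting r t 𝓕 =
  (A : Fin r → Subset _) → (∀ i → A i ∈ 𝓕) → t ≤ ∣ ⋂ (tabulate A) ∣

IsTCover : ∀ {n} → ℕ → Family n → Subset n → Set
IsTCover t 𝓕 T = ∀ F → F ∈ 𝓕 → t ≤ ∣ T ∩ F ∣

CoveringNumberIs : ∀ {n} → ℕ → Family n → ℕ → Set
CoveringNumberIs {n} t 𝓕 s =
  (Σ (Subset n) λ T → IsTCover t 𝓕 T × ∣ T ∣ ≡ s)
  × (∀ T → IsTCover t 𝓕 T → s ≤ ∣ T ∣)

{-# OPTIONS --safe #-}
-- If T is a c-cover of 𝓕 with c ≥ t, deleting c − t of its
-- points leaves a t-cover, so |T| ≥ (s − t) + c. Hence, by induction on q, the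
-- intersection of any r − q members of 𝓕 has ≥ q(s − t) + t points: for q = 0
-- this is r-wise t-intersection, and adding one further member shows the
-- intersection for q + 1 is a (q(s − t) + t)-cover. Take q = r − 2.
module Submission where

open import Defs
open import Data.Nat using (ℕ; _≤_; _≥_; _+_; _*_; _∸_; zero; suc; s≤s)
open import Data.Nat.Properties
open import Data.Bool using (true; false)
open import Data.Vec using (_∷_)
open import Data.Fin.Subset using (Subset; _∩_; ⋂; ∣_∣)
open import Data.Fin.Subset.Properties using (p⊆q⇒∣p∣≤∣q∣; p∩q⊆p; ∩-comm; ∩-identityʳ)
open import Data.List using (List; length; lookup) renaming (_∷_ to _∷ₗ_; [] to []ₗ)
open import Data.List.Properties using (tabulate-lookup)
open import Data.List.Relation.Unary.All as All using (All) renaming (_∷_ to _∷ᵃ_; [] to []ᵃ)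
open import Data.List.Membership.Propositional.Properties using (∈-lookup)
open import Data.Product using (Σ; _×_; _,_)
open import Relation.Binary.PropositionalEquality
open import Relation.Unary using (_∈_)

∣p∩q∣≤∣p∣ : ∀ {n} (p q : Subset n) → ∣ p ∩ q ∣ ≤ ∣ p ∣
∣p∩q∣≤∣p∣ p q = p⊆q⇒∣p∣≤∣q∣ (p∩q⊆p p q)

∃-remove : ∀ {n} (T : Subset n) d → d ≤ ∣ T ∣ →
  Σ (Subset n) λ T′ → ∣ T′ ∣ + d ≡ ∣ T ∣ × (∀ G → ∣ T ∩ G ∣ ≤ ∣ T′ ∩ G ∣ + d)
∃-remove T zero _ = T , +-identityʳ _ , λ G → ≤-reflexive (sym (+-identityʳ _))
∃-remove (true ∷ T) (suc d) (s≤s d≤∣T∣) with ∃-remove T d d≤∣T∣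
... | T′ , ∣T′∣+d≡∣T∣ , removed = false ∷ T′ , trans (+-suc _ d) (cong suc ∣T′∣+d≡∣T∣) , removed′
  where
  removed′ : ∀ G → ∣ (true ∷ T) ∩ G ∣ ≤ ∣ (false ∷ T′) ∩ G ∣ + suc d
  removed′ (true ∷ G)  = ≤-trans (s≤s (removed G)) (≤-reflexive (sym (+-suc _ d)))
  removed′ (false ∷ G) = ≤-trans (removed G) (+-monoʳ-≤ _ (n≤1+n d))
∃-remove (false ∷ T) (suc d) d≤∣T∣ with ∃-remove T (suc d) d≤∣T∣
... | T′ , ∣T′∣+d≡∣T∣ , removed = false ∷ T′ , ∣T′∣+d≡∣T∣ , removed′
  where
  removed′ : ∀ G → ∣ (false ∷ T) ∩ G ∣ ≤ ∣ (false ∷ T′) ∩ G ∣ + suc d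
  removed′ (true ∷ G)  = removed G
  removed′ (false ∷ G) = removed G

module _ {n} {𝓕 : Family n} {A : Subset n} (A∈𝓕 : A ∈ 𝓕) where

  cover⇒≤∣T∣ : ∀ {c} T → IsTCover c 𝓕 T → c ≤ ∣ T ∣
  cover⇒≤∣T∣ T cover = ≤-trans (cover A A∈𝓕) (∣p∩q∣≤∣p∣ T A)

  ∃-smaller-cover : ∀ {c} t T → IsTCover c 𝓕 T → t ≤ c →
    Σ (Subset n) λ T′ → IsTCover t 𝓕 T′ × ∣ T′ ∣ + (c ∸ t) ≡ ∣ T ∣
  ∃-smaller-cover {c} t T cover t≤c
    with ∃-remove T (c ∸ t) (≤-trans (m∸n≤m c t) (cover⇒≤∣T∣ T cover))
  ... | T′ , ∣T′∣+d≡∣T∣ , removed = T′ , cover′ , ∣T′∣+d≡∣T∣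
    where
    cover′ : IsTCover t 𝓕 T′
    cover′ F F∈𝓕 = +-cancelʳ-≤ (c ∸ t) t ∣ T′ ∩ F ∣ (begin
      t + (c ∸ t)          ≡⟨ m+[n∸m]≡n t≤c ⟩
      c                    ≤⟨ cover F F∈𝓕 ⟩
      ∣ T ∩ F ∣            ≤⟨ removed F ⟩
      ∣ T′ ∩ F ∣ + (c ∸ t) ∎)
      where open ≤-Reasoning

  c-cover⇒[s∸t]+c≤∣T∣ : ∀ {t s c} T → CoveringNumberIs t 𝓕 s →
    IsTCover c 𝓕 T → t ≤ c → (s ∸ t) + c ≤ ∣ T ∣
  c-cover⇒[s∸t]+c≤∣T∣ {t} {s} {c} T (_ , minimal) cover t≤c
    with ∃-smaller-cover t T cover t≤c
  ... | T′ , cover′ , ∣T′∣+d≡∣T∣ = begin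
    (s ∸ t) + c                ≡⟨ cong ((s ∸ t) +_) (sym (m+[n∸m]≡n t≤c)) ⟩
    (s ∸ t) + (t + (c ∸ t))    ≡⟨ sym (+-assoc (s ∸ t) t (c ∸ t)) ⟩
    (s ∸ t) + t + (c ∸ t)      ≤⟨ +-monoˡ-≤ (c ∸ t) (+-monoˡ-≤ t (∸-monoˡ-≤ t (minimal T′ cover′))) ⟩
    (∣ T′ ∣ ∸ t) + t + (c ∸ t) ≡⟨ cong (_+ (c ∸ t)) (m∸n+n≡m (cover⇒≤∣T∣ T′ cover′)) ⟩
    ∣ T′ ∣ + (c ∸ t)           ≡⟨ ∣T′∣+d≡∣T∣ ⟩
    ∣ T ∣                      ∎
    where open ≤-Reasoning

module _ {n r t s} {𝓕 : Family n}
         (rwise : IsRWiseIntersecting r t 𝓕) (τ≡s : CoveringNumberIs t 𝓕 s) where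

  ⋂-rwise : ∀ (L : List (Subset n)) → length L ≡ r → All (_∈ 𝓕) L → t ≤ ∣ ⋂ L ∣
  ⋂-rwise L refl L⊆𝓕 = subst (λ M → t ≤ ∣ ⋂ M ∣) (tabulate-lookup L)
    (rwise (lookup L) (λ i → All.lookup L⊆𝓕 (∈-lookup i)))

  ⋂-lowerBound : ∀ q (L : List (Subset n)) {A} → A ∈ 𝓕 → length L + q ≡ r →
    All (_∈ 𝓕) L → q * (s ∸ t) + t ≤ ∣ ⋂ L ∣
  ⋂-lowerBound zero L _ ∣L∣≡r L⊆𝓕 = ⋂-rwise L (trans (sym (+-identityʳ _)) ∣L∣≡r) L⊆𝓕
  ⋂-lowerBound (suc q) L A∈𝓕 ∣L∣+q≡r L⊆𝓕 = subst (_≤ ∣ ⋂ L ∣) (sym (+-assoc (s ∸ t) _ t))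
    (c-cover⇒[s∸t]+c≤∣T∣ A∈𝓕 (⋂ L) τ≡s cover (m≤n+m t _))
    where
    cover : IsTCover (q * (s ∸ t) + t) 𝓕 (⋂ L)
    cover G G∈𝓕 = subst (λ X → _ ≤ ∣ X ∣) (∩-comm G (⋂ L))
      (⋂-lowerBound q (G ∷ₗ L) A∈𝓕 (trans (sym (+-suc (length L) q)) ∣L∣+q≡r) (G∈𝓕 ∷ᵃ L⊆𝓕))

lemma4p1 : (r t k n s : ℕ) → r ≥ 3 → t ≥ 1 → k ≥ 1 → n ≥ 1 →
    (𝓕 : Family n) → IsUniform k 𝓕 → IsRWiseIntersecting r t 𝓕 →
    CoveringNumberIs t 𝓕 s →
    IsIntersecting ((r ∸ 2) * (s ∸ t) + t) 𝓕
lemma4p1 r t k n s r≥3 _ _ _ 𝓕 _ rwise τ≡s A B A∈𝓕 B∈𝓕 =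
  subst (λ X → _ ≤ ∣ A ∩ X ∣) (∩-identityʳ B)
    (⋂-lowerBound rwise τ≡s (r ∸ 2) (A ∷ₗ B ∷ₗ []ₗ) A∈𝓕
      (m+[n∸m]≡n (≤-trans (n≤1+n 2) r≥3)) (A∈𝓕 ∷ᵃ B∈𝓕 ∷ᵃ []ᵃ))
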